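{- Let $\mathcal{R}=(V,R)$ be the random graph with a fixed enumeration $V=\{v_0,v_1,\dots\}$ and let $\mathcal{K}\subset\mathrm{Aut}(\mathcal{R})$ be compact. Let $p,p'$ be finite partial automorphisms of $\mathcal{R}$, $w_0$ a vertex with $p(w_0)\neq p'(w_0)$, and $N\in\omega$. Then there exist two disjoint finite sets $A,A'\subset V\setminus\{v_i:i\le N\}$ such that for every vertex $v$, if $wRv$ for every $w\in A$ and $\neg(w'Rv)$ for every $w'\in A'$, then $h(v)\neq h'(v)$ for all $h\in[p]\cap\mathcal{K}$ and $h'\in[p']\cap\mathcal{K}$.
   Context: The random graph $\mathcal{R}=(V,R)$ is the unique countable graph such that for every pair of finite disjoint $A,B\subset V$ there is $v$ with $xRv$ for $x\in A$ and $\neg(yRv)$ for $y\in B$; $\mathrm{Aut}(\mathcal{R})$ carries the topology of pointwise convergence. A finite partial automorphism is a finite injective map between subsets of $V$ preserving $R$ and non-$R$. For a finite partial automorphism $p$, $[p]=\{f\in\mathrm{Aut}(\mathcal{R}): p\subset f\}$. The hypothesis $p(w_0)\neq p'(w_0)$ includes that $w_0\in\mathrm{dom}(p)\cap\mathrm{dom}(p')$. -}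

module Defs where

open import Data.Nat using (ℕ; _<_)
open import Data.Bool using (Bool; true; false)
open import Data.Product using (Σ; ∃; _×_; _,_; proj₁; proj₂)
open import Data.List using (List)
open import Data.List.Relation.Unary.All using (All)
open import Data.List.Relation.Unary.Any using (Any)
open import Data.List.Membership.Propositional using (_∈_; _∉_)
open import Relation.Binary.PropositionalEquality using (_≡_; _≢_)

-- The vertex set V is ℕ, with the fixed enumeration v_i = i.
-- The edge relation is given by a Bool-valued function E (xRy ⟺ E x y ≡ true).

Disjoint : List ℕ → List ℕ → Set
Disjoint A B = All (λ x → x ∉ B) A

record RandomGraph : Set where
  field
    E      : ℕ → ℕ → Bool
    E-sym  : ∀ x y → E x y ≡ E y x
    E-irr  : ∀ x → E x x ≡ false
    extend : (A B : List ℕ) → Disjoint A B →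
             ∃ λ v → All (λ x → E x v ≡ true) A × All (λ y → E y v ≡ false) B

module _ (𝓡 : RandomGraph) where
  open RandomGraph 𝓡

  record Aut : Set where
    field
      fun      : ℕ → ℕ
      inv      : ℕ → ℕ
      inv-l    : ∀ x → inv (fun x) ≡ x
      inv-r    : ∀ x → fun (inv x) ≡ x
      preserve : ∀ x y → E (fun x) (fun y) ≡ E x y
  open Aut public

  -- Topology of pointwise convergence on Aut(R): U is open iff every f ∈ U has a
  -- basic neighbourhood {g : g agrees with f on a finite set F} contained in U.
  IsOpen : (Aut → Set) → Set
  IsOpen U = ∀ f → U f → ∃ λ (F : List ℕ) →
               ∀ g → All (λ x → fun g x ≡ fun f x) F → U g

  IsCompact : (Aut → Set) → Set₁
  IsCompact K = ∀ {I : Set} (U : I → Aut → Set) → (∀ i → IsOpen (U i)) →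
                (∀ f → K f → ∃ λ i → U i f) →
                ∃ λ (is : List I) → ∀ f → K f → Any (λ i → U i f) is

  record PartialAut : Set where
    field
      graph      : List (ℕ × ℕ)
      functional : ∀ {a b c d} → (a , b) ∈ graph → (c , d) ∈ graph → a ≡ c → b ≡ d
      injective  : ∀ {a b c d} → (a , b) ∈ graph → (c , d) ∈ graph → b ≡ d → a ≡ c
      preservesE : ∀ {a b c d} → (a , b) ∈ graph → (c , d) ∈ graph → E a c ≡ E b d
  open PartialAut public

  Extends : PartialAut → Aut → Set
  Extends p f = All (λ ab → fun f (proj₁ ab) ≡ proj₂ ab) (graph p)

  DifferAt : PartialAut → PartialAut → ℕ → Set
  DifferAt p p' w = ∃ λ b → ∃ λ b' →
    (w , b) ∈ graph p × (w , b') ∈ graph p' × b ≢ b'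

module Submission where

-- Let b = p(w₀) ≠ b' = p'(w₀).  By compactness of K every
-- locally constant map on K takes only finitely many values.  Applied to
-- h ↦ h(i) for i ≤ N, this yields a finite set X containing h(i) for all
-- h ∈ K and i ≤ N.  The extension property then gives a vertex t ∉ X with
-- b R t and ¬ b' R t.  Applied once more to h ↦ h⁻¹(t), compactness gives a
-- finite set Y of all preimages of t under K; each such preimage exceeds N
-- (since t ∉ X).  Split Y by adjacency to w₀: A = {y ∈ Y : y R w₀},
-- A' = {y ∈ Y : ¬ y R w₀}.  For h ∈ [p] ∩ K we get h⁻¹(t) R w₀ iff t R b,
-- so h⁻¹(t) ∈ A, and likewise h'⁻¹(t) ∈ A' for h' ∈ [p'] ∩ K.  If v is
-- joined to A and not to A', then t R h(v) but ¬ t R h'(v), so h(v) ≠ h'(v).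

open import Defs
open import Data.Nat using (ℕ; suc; _<_; _<?_; s≤s)
open import Data.Nat.Properties using (≰⇒>)
open import Data.Bool using (Bool; true; false)
import Data.Bool as Bool
open import Data.Product using (∃; _×_; _,_; proj₁; proj₂)
open import Data.List using (List; []; _∷_; _++_; filter; upTo)
open import Data.List.Relation.Unary.All as All using (All; []; _∷_)
open import Data.List.Relation.Unary.All.Properties using (all-filter)
open import Data.List.Relation.Unary.Any using (here; there)
open import Data.List.Membership.Propositional using (_∈_; _∉_)
open import Data.List.Membership.Propositional.Properties
  using (∈-++⁺ˡ; ∈-++⁺ʳ; ∈-filter⁺; ∈-filter⁻; ∈-upTo⁺)
open import Relation.Binary.PropositionalEquality
  using (_≡_; _≢_; refl; sym; trans; cong; subst; module ≡-Reasoning)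
open import Relation.Nullary.Decidable using (_×-dec_)
open import Function using (case_of_)
open import Relation.Unary using (Decidable)

module _ (𝓡 : RandomGraph) where
  open RandomGraph 𝓡
  open ≡-Reasoning

  LocallyConstant : {X : Set} → (Aut 𝓡 → X) → Set
  LocallyConstant F = ∀ f → ∃ λ (D : List ℕ) →
    ∀ g → All (λ x → fun g x ≡ fun f x) D → F g ≡ F f

  -- Its fibres form an open cover, so on a compact set it has finite range.
  finiteRange : {X : Set} (K : Aut 𝓡 → Set) → IsCompact 𝓡 K →
                (F : Aut 𝓡 → X) → LocallyConstant F →
                ∃ λ (xs : List X) → ∀ f → K f → F f ∈ xs
  finiteRange {X} K cK F lc = cK fibre fibre-open (λ f _ → F f , refl)
    where
    fibre : X → Aut 𝓡 → Set
    fibre x f = F f ≡ x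

    fibre-open : ∀ x → IsOpen 𝓡 (fibre x)
    fibre-open x f Ff≡x = proj₁ (lc f) , λ g agree → trans (proj₂ (lc f) g agree) Ff≡x

  evaluation-locallyConstant : ∀ x → LocallyConstant (λ f → fun f x)
  evaluation-locallyConstant x f = x ∷ [] , λ g agree → All.head agree

  -- So is taking the preimage of a vertex t: g⁻¹(t) = f⁻¹(t) as soon as g
  -- agrees with f at f⁻¹(t).
  preimage-locallyConstant : ∀ t → LocallyConstant (λ f → inv f t)
  preimage-locallyConstant t f = inv f t ∷ [] , λ g agree → begin
      inv g t                   ≡⟨ cong (inv g) (sym (trans (All.head agree) (inv-r f t))) ⟩
      inv g (fun g (inv f t))   ≡⟨ inv-l g (inv f t) ⟩
      inv f t                   ∎

  finiteImage : (K : Aut 𝓡 → Set) → IsCompact 𝓡 K → (D : List ℕ) →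
                ∃ λ (X : List ℕ) → ∀ f → K f → ∀ {x} → x ∈ D → fun f x ∈ X
  finiteImage K cK [] = [] , λ _ _ ()
  finiteImage K cK (d ∷ D)
    with finiteRange K cK (λ f → fun f d) (evaluation-locallyConstant d) | finiteImage K cK D
  ... | Xd , d-image | XD , D-image = Xd ++ XD , λ where
    f Kf (here refl)  → ∈-++⁺ˡ (d-image f Kf)
    f Kf (there x∈D) → ∈-++⁺ʳ Xd (D-image f Kf x∈D)

  adjacent⇒distinct : ∀ {x y} → E x y ≡ true → x ≢ y
  adjacent⇒distinct {x} Exy refl with () ← trans (sym Exy) (E-irr x)

  -- An auxiliary s joined to a and all of X rules out t ∈ X,
  -- since t is required to be non-adjacent to s (and s ≠ a as a R s).
  freshSeparator : ∀ {a a'} → a ≢ a' → (X : List ℕ) →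
                   ∃ λ t → E a t ≡ true × E a' t ≡ false × t ∉ X
  freshSeparator {a} {a'} a≢a' X with extend (a ∷ X) [] (All.tabulate λ _ ())
  ... | s , a-s ∷ X-s , _
    with extend (a ∷ []) (a' ∷ s ∷ []) (a∉a's ∷ [])
    where
    a∉a's : a ∉ a' ∷ s ∷ []
    a∉a's (here a≡a')       = a≢a' a≡a'
    a∉a's (there (here a≡s)) = adjacent⇒distinct a-s a≡s
  ... | t , a-t ∷ [] , a'-t ∷ s-t ∷ [] = t , a-t , a'-t , t∉X
    where
    t∉X : t ∉ X
    t∉X t∈X with () ← trans (sym (All.lookup X-s t∈X)) (trans (E-sym t s) s-t)

  preimage-adjacency : ∀ (h : Aut 𝓡) t v → E (inv h t) v ≡ E t (fun h v)
  preimage-adjacency h t v =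
    trans (sym (preserve h (inv h t) v)) (cong (λ z → E z (fun h v)) (inv-r h t))

  separation : (K : Aut 𝓡 → Set) (N w₀ t : ℕ) (Y : List ℕ) →
               (∀ h → K h → inv h t ∈ Y) → (∀ h → K h → N < inv h t) →
               ∃ λ (A : List ℕ) → ∃ λ (A' : List ℕ) →
                 Disjoint A A' × All (λ a → N < a) A × All (λ a → N < a) A' ×
                 (∀ v → All (λ w → E w v ≡ true) A → All (λ w → E w v ≡ false) A' →
                  ∀ (h h' : Aut 𝓡) → K h → K h' →
                  E t (fun h w₀) ≡ true → E t (fun h' w₀) ≡ false →
                  fun h v ≢ fun h' v)
  separation K N w₀ t Y preimage∈Y preimage-large =
    filter (side? true) Y , filter (side? false) Y ,
    All.tabulate sides-disjoint ,
    All.map proj₁ (all-filter (side? true) Y) ,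
    All.map proj₁ (all-filter (side? false) Y) ,
    separated
    where
    side? : (β : Bool) → Decidable (λ y → N < y × E y w₀ ≡ β)
    side? β y = (N <? y) ×-dec (E y w₀ Bool.≟ β)

    sides-disjoint : ∀ {y} → y ∈ filter (side? true) Y → y ∉ filter (side? false) Y
    sides-disjoint y∈A y∈A' with () ← trans (sym (proj₂ (proj₂ (∈-filter⁻ (side? true) {xs = Y} y∈A))))
                                            (proj₂ (proj₂ (∈-filter⁻ (side? false) {xs = Y} y∈A')))

    preimage-side : ∀ {β} h → K h → E t (fun h w₀) ≡ β → inv h t ∈ filter (side? β) Y
    preimage-side {β} h Kh t-hw₀ = ∈-filter⁺ (side? β) (preimage∈Y h Kh)
      (preimage-large h Kh , trans (preimage-adjacency h t w₀) t-hw₀)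

    separated : ∀ v → All (λ w → E w v ≡ true) (filter (side? true) Y) →
                All (λ w → E w v ≡ false) (filter (side? false) Y) →
                ∀ (h h' : Aut 𝓡) → K h → K h' →
                E t (fun h w₀) ≡ true → E t (fun h' w₀) ≡ false → fun h v ≢ fun h' v
    separated v adjA nonadjA' h h' Kh Kh' t-hw₀ t-h'w₀ hv≡h'v with () ← begin
        true                ≡⟨ sym (All.lookup adjA (preimage-side h Kh t-hw₀)) ⟩
        E (inv h t) v       ≡⟨ preimage-adjacency h t v ⟩
        E t (fun h v)       ≡⟨ cong (E t) hv≡h'v ⟩
        E t (fun h' v)      ≡⟨ sym (preimage-adjacency h' t v) ⟩
        E (inv h' t) v      ≡⟨ All.lookup nonadjA' (preimage-side h' Kh' t-h'w₀) ⟩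
        false               ∎

  preimage-aboveN : (K : Aut 𝓡 → Set) (N t : ℕ) (X : List ℕ) →
                    (∀ f → K f → ∀ {x} → x ∈ upTo (suc N) → fun f x ∈ X) → t ∉ X →
                    ∀ h → K h → N < inv h t
  preimage-aboveN K N t X image t∉X h Kh = ≰⇒> λ preimage≤N →
    t∉X (subst (_∈ X) (inv-r h t) (image h Kh (∈-upTo⁺ (s≤s preimage≤N))))

  extension-adjacency : (q : PartialAut 𝓡) (h : Aut 𝓡) (t : ℕ) → Extends 𝓡 q h →
                        ∀ {w c} → (w , c) ∈ graph q → E t (fun h w) ≡ E c t
  extension-adjacency q h t q⊂h {w} {c} w↦c =
    trans (cong (E t) (All.lookup q⊂h w↦c)) (E-sym t c)

lemma2p4 : (𝓡 : RandomGraph) → (K : Aut 𝓡 → Set) → IsCompact 𝓡 K →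
           (p p' : PartialAut 𝓡) → (w₀ : ℕ) → DifferAt 𝓡 p p' w₀ → (N : ℕ) →
           ∃ λ (A : List ℕ) → ∃ λ (A' : List ℕ) →
             Disjoint A A' × All (λ a → N < a) A × All (λ a → N < a) A' ×
             (∀ v → All (λ w → RandomGraph.E 𝓡 w v ≡ true) A →
                    All (λ w → RandomGraph.E 𝓡 w v ≡ false) A' →
                    ∀ (h h' : Aut 𝓡) → Extends 𝓡 p h → K h → Extends 𝓡 p' h' → K h' →
                    fun {𝓡} h v ≢ fun {𝓡} h' v)
lemma2p4 𝓡 K cK p p' w₀ (b , b' , w₀↦b , w₀↦b' , b≢b') N =
  case finiteImage 𝓡 K cK (upTo (suc N)) of λ where
    (X , image) → case freshSeparator 𝓡 b≢b' X of λ where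
      (t , b-t , b'-t , t∉X) →
        case finiteRange 𝓡 K cK (λ h → inv h t) (preimage-locallyConstant 𝓡 t) of λ where
          (Y , preimage∈Y) →
            case separation 𝓡 K N w₀ t Y preimage∈Y (preimage-aboveN 𝓡 K N t X image t∉X) of λ where
              (A , A' , disjoint , A>N , A'>N , separated) →
                A , A' , disjoint , A>N , A'>N ,
                λ v adjA nonadjA' h h' p⊂h Kh p'⊂h' Kh' →
                  separated v adjA nonadjA' h h' Kh Kh'
                    (trans (extension-adjacency 𝓡 p h t p⊂h w₀↦b) b-t)
                    (trans (extension-adjacency 𝓡 p' h' t p'⊂h' w₀↦b') b'-t)
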